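{- No proper RML** algebra, proper *RML** algebra, proper aRML** algebra or proper *aRML** algebra satisfies (pimpl).
   Context: Algebras are $(A,\to,1)$ of type $(2,0)$. Properties, for all $x,y,z\in A$: (Re) $x\to x=1$; (M) $1\to x=x$; (L) $x\to1=1$; (Ex) $x\to(y\to z)=y\to(x\to z)$; (An) $x\to y=1=y\to x\Rightarrow x=y$; (B) $(y\to z)\to[(x\to y)\to(x\to z)]=1$; (BB) $(y\to z)\to[(z\to x)\to(y\to x)]=1$; (*) $y\to z=1\Rightarrow (x\to y)\to(x\to z)=1$; (**) $y\to z=1\Rightarrow(z\to x)\to(y\to x)=1$; (pi) $y\to(y\to x)=y\to x$; (pimpl) $x\to(y\to z)=(x\to y)\to(x\to z)$. A proper RML** algebra satisfies (Re), (M), (L), (**) and none of (An), (Ex), (BB), (*), (B), (pi). A proper *RML** algebra satisfies (Re), (M), (L), (*), (**) and none of (An), (Ex), (B), (BB), (pi). A proper aRML** algebra satisfies (Re), (M), (L), (An), (**) and none of (Ex), (BB), (*), (B), (pi). A proper *aRML** algebra satisfies (Re), (M), (L), (An), (*), (**) and none of (Ex), (B), (BB), (pi). -}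

module Defs where

open import Level using (Level)
open import Data.Product using (_×_)
open import Data.Sum using (_⊎_)
open import Relation.Nullary using (¬_)
open import Relation.Binary.PropositionalEquality using (_≡_)

module _ {a : Level} {A : Set a} (_⇒_ : A → A → A) (one : A) where

  Re : Set a
  Re = ∀ x → x ⇒ x ≡ one

  M : Set a
  M = ∀ x → one ⇒ x ≡ x

  L : Set a
  L = ∀ x → x ⇒ one ≡ one

  Ex : Set a
  Ex = ∀ x y z → x ⇒ (y ⇒ z) ≡ y ⇒ (x ⇒ z)

  An : Set a
  An = ∀ x y → x ⇒ y ≡ one → y ⇒ x ≡ one → x ≡ y

  B : Set a
  B = ∀ x y z → (y ⇒ z) ⇒ ((x ⇒ y) ⇒ (x ⇒ z)) ≡ one

  BB : Set a
  BB = ∀ x y z → (y ⇒ z) ⇒ ((z ⇒ x) ⇒ (y ⇒ x)) ≡ one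

  Star : Set a
  Star = ∀ x y z → y ⇒ z ≡ one → (x ⇒ y) ⇒ (x ⇒ z) ≡ one

  StarStar : Set a
  StarStar = ∀ x y z → y ⇒ z ≡ one → (z ⇒ x) ⇒ (y ⇒ x) ≡ one

  Pi : Set a
  Pi = ∀ x y → y ⇒ (y ⇒ x) ≡ y ⇒ x

  Pimpl : Set a
  Pimpl = ∀ x y z → x ⇒ (y ⇒ z) ≡ (x ⇒ y) ⇒ (x ⇒ z)

  ProperRML** : Set a
  ProperRML** = Re × M × L × StarStar
    × ¬ An × ¬ Ex × ¬ BB × ¬ Star × ¬ B × ¬ Pi

  Proper*RML** : Set a
  Proper*RML** = Re × M × L × Star × StarStar
    × ¬ An × ¬ Ex × ¬ B × ¬ BB × ¬ Pi

  ProperaRML** : Set a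
  ProperaRML** = Re × M × L × An × StarStar
    × ¬ Ex × ¬ BB × ¬ Star × ¬ B × ¬ Pi

  Proper*aRML** : Set a
  Proper*aRML** = Re × M × L × An × Star × StarStar
    × ¬ Ex × ¬ B × ¬ BB × ¬ Pi

-- Every one of the four classes excludes (pi), while (Re), (M) and (pimpl)
-- together force it: y ⇒ (y ⇒ x) = (y ⇒ y) ⇒ (y ⇒ x) = 1 ⇒ (y ⇒ x) = y ⇒ x.

module Submission where

open import Defs
open import Level using (Level)
open import Data.Sum using (_⊎_; inj₁; inj₂)
open import Data.Product using (_×_; _,_)
open import Relation.Nullary using (¬_)
open import Relation.Binary.PropositionalEquality using (_≡_; cong; module ≡-Reasoning)

module _ {a : Level} {A : Set a} {_⇒_ : A → A → A} {one : A} where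

  Re∧M∧Pimpl⇒Pi : Re _⇒_ one → M _⇒_ one → Pimpl _⇒_ one → Pi _⇒_ one
  Re∧M∧Pimpl⇒Pi re m pimpl x y = begin
    y ⇒ (y ⇒ x)          ≡⟨ pimpl y y x ⟩
    (y ⇒ y) ⇒ (y ⇒ x)    ≡⟨ cong (_⇒ (y ⇒ x)) (re y) ⟩
    one ⇒ (y ⇒ x)        ≡⟨ m (y ⇒ x) ⟩
    y ⇒ x                ∎
    where open ≡-Reasoning

  Re∧M∧¬Pi : Set a
  Re∧M∧¬Pi = Re _⇒_ one × M _⇒_ one × ¬ Pi _⇒_ one

  Re∧M∧¬Pi⇒¬Pimpl : Re∧M∧¬Pi → ¬ Pimpl _⇒_ one
  Re∧M∧¬Pi⇒¬Pimpl (re , m , ¬pi) pimpl = ¬pi (Re∧M∧Pimpl⇒Pi re m pimpl)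

  ProperRML**⇒Re∧M∧¬Pi : ProperRML** _⇒_ one → Re∧M∧¬Pi
  ProperRML**⇒Re∧M∧¬Pi (re , m , _ , _ , _ , _ , _ , _ , _ , ¬pi) = re , m , ¬pi

  Proper*RML**⇒Re∧M∧¬Pi : Proper*RML** _⇒_ one → Re∧M∧¬Pi
  Proper*RML**⇒Re∧M∧¬Pi (re , m , _ , _ , _ , _ , _ , _ , _ , ¬pi) = re , m , ¬pi

  ProperaRML**⇒Re∧M∧¬Pi : ProperaRML** _⇒_ one → Re∧M∧¬Pi
  ProperaRML**⇒Re∧M∧¬Pi (re , m , _ , _ , _ , _ , _ , _ , _ , ¬pi) = re , m , ¬pi

  Proper*aRML**⇒Re∧M∧¬Pi : Proper*aRML** _⇒_ one → Re∧M∧¬Pi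
  Proper*aRML**⇒Re∧M∧¬Pi (re , m , _ , _ , _ , _ , _ , _ , _ , ¬pi) = re , m , ¬pi

corollary6p7 : {a : Level} {A : Set a} (_⇒_ : A → A → A) (one : A) →
    (ProperRML** _⇒_ one ⊎ Proper*RML** _⇒_ one ⊎ ProperaRML** _⇒_ one ⊎ Proper*aRML** _⇒_ one) →
    ¬ Pimpl _⇒_ one
corollary6p7 _ _ (inj₁ rml)                 = Re∧M∧¬Pi⇒¬Pimpl (ProperRML**⇒Re∧M∧¬Pi rml)
corollary6p7 _ _ (inj₂ (inj₁ *rml))         = Re∧M∧¬Pi⇒¬Pimpl (Proper*RML**⇒Re∧M∧¬Pi *rml)
corollary6p7 _ _ (inj₂ (inj₂ (inj₁ arml)))  = Re∧M∧¬Pi⇒¬Pimpl (ProperaRML**⇒Re∧M∧¬Pi arml)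
corollary6p7 _ _ (inj₂ (inj₂ (inj₂ *arml))) = Re∧M∧¬Pi⇒¬Pimpl (Proper*aRML**⇒Re∧M∧¬Pi *arml)
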